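{- Let $G=(V,E)$ be a finite simple undirected graph. Then \[ k(G) \geq \max_{m \in \{1, \ldots, |V|\}} \; \min_{U \in \binom{V}{m}} \Big( \theta_E(E_G[U]; N_G[U]) - |U| + 1 \Big). \]
   Context: All graphs are finite, simple and undirected. The competition graph $C(D)$ of a digraph $D$ is the graph with vertex set $V(D)$ in which two distinct vertices $x,y$ are adjacent if and only if there is a vertex $v$ with $(x,v),(y,v)$ both arcs of $D$. The competition number $k(G)$ of a graph $G$ is the minimum nonnegative integer $k$ such that $G$ together with $k$ new isolated vertices is the competition graph of some acyclic digraph (a digraph with no directed cycles). A clique of $G$ is a set of vertices inducing a complete subgraph; an edge is covered by a clique if both endpoints lie in it. For $F \subseteq E(G)$, an edge clique cover of $F$ in $G$ is a family of cliques of $G$ such that every edge of $F$ is covered by some clique of the family, and $\theta_E(F;G)$ is the minimum size of such a family. For $U \subseteq V(G)$: $N_G[U]$ is the set $U$ together with all vertices adjacent to some vertex of $U$, and the same symbol denotes the subgraph of $G$ induced by this set; $E_G[U]$ is the set of edges of $G$ having at least one endpoint in $U$. $\binom{V}{m}$ denotes the set of all $m$-element subsets of $V$. -}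

module Defs where

open import Data.Nat using (ℕ; _+_; _≤_)
open import Data.Bool using (Bool; true; false)
open import Data.Fin using (Fin; splitAt)
open import Data.Fin.Subset using (Subset; _∈_; _⊆_; ∣_∣)
open import Data.Sum using (_⊎_; inj₁; inj₂)
open import Data.Product using (Σ; ∃; _×_; _,_)
open import Relation.Nullary using (¬_)
open import Relation.Binary.PropositionalEquality using (_≡_; _≢_)
open import Relation.Binary.Construct.Closure.Transitive using (TransClosure)

record Graph (n : ℕ) : Set where
  field
    adj    : Fin n → Fin n → Bool
    sym    : ∀ x y → adj x y ≡ adj y x
    irrefl : ∀ x → adj x x ≡ false
open Graph public

Adj : ∀ {n} → Graph n → Fin n → Fin n → Set
Adj G x y = adj G x y ≡ true

Digraph : ℕ → Set
Digraph N = Fin N → Fin N → Bool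

Arc : ∀ {N} → Digraph N → Fin N → Fin N → Set
Arc D x y = D x y ≡ true

Acyclic : ∀ {N} → Digraph N → Set
Acyclic D = ∀ x → ¬ TransClosure (Arc D) x x

CompAdj : ∀ {N} → Digraph N → Fin N → Fin N → Set
CompAdj D x y = x ≢ y × ∃ λ v → Arc D x v × Arc D y v

-- G together with k new isolated vertices (vertices n, …, n+k-1).
addIsolated : ∀ {n} → Graph n → (k : ℕ) → Fin (n + k) → Fin (n + k) → Bool
addIsolated {n} G k x y with splitAt n x | splitAt n y
... | inj₁ i | inj₁ j = adj G i j
... | inj₁ _ | inj₂ _ = false
... | inj₂ _ | inj₁ _ = false
... | inj₂ _ | inj₂ _ = false

IsCompetitionGraphOf : ∀ {n} → Graph n → (k : ℕ) → Digraph (n + k) → Set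
IsCompetitionGraphOf G k D =
  ∀ x y → (addIsolated G k x y ≡ true → CompAdj D x y)
        × (CompAdj D x y → addIsolated G k x y ≡ true)

Admissible : ∀ {n} → Graph n → ℕ → Set
Admissible {n} G k = Σ (Digraph (n + k)) λ D → Acyclic D × IsCompetitionGraphOf G k D

IsCompetitionNumber : ∀ {n} → Graph n → ℕ → Set
IsCompetitionNumber G k = Admissible G k × (∀ k′ → Admissible G k′ → k ≤ k′)

ClosedNbhd : ∀ {n} → Graph n → Subset n → Fin n → Set
ClosedNbhd G U x = x ∈ U ⊎ ∃ λ u → u ∈ U × Adj G u x

EdgesAt : ∀ {n} → Graph n → Subset n → Fin n → Fin n → Set
EdgesAt G U x y = Adj G x y × (x ∈ U ⊎ y ∈ U)

IsCliqueIn : ∀ {n} → Graph n → (W : Fin n → Set) → Subset n → Set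
IsCliqueIn G W C = (∀ x → x ∈ C → W x) × (∀ x y → x ∈ C → y ∈ C → x ≢ y → Adj G x y)

IsEdgeCliqueCover : ∀ {n} → Graph n → (W : Fin n → Set) → (F : Fin n → Fin n → Set)
                    → (t : ℕ) → (Fin t → Subset n) → Set
IsEdgeCliqueCover G W F t C =
  (∀ i → IsCliqueIn G W (C i)) × (∀ x y → F x y → ∃ λ i → x ∈ C i × y ∈ C i)

IsThetaE : ∀ {n} → Graph n → (W : Fin n → Set) → (F : Fin n → Fin n → Set) → ℕ → Set
IsThetaE {n} G W F t =
  (Σ (Fin t → Subset n) λ C → IsEdgeCliqueCover G W F t C)
  × (∀ t′ (C : Fin t′ → Subset n) → IsEdgeCliqueCover G W F t′ C → t ≤ t′)

module Submission where

-- Let D be an acyclic digraph whose competition graph is G together with k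
-- isolated vertices, and write R for the arcs of D between vertices of G.
-- Since R is acyclic on a finite set, every set missing some vertex can be
-- extended by a "sink" whose R-successors all lie in the set.  Starting from ∅
-- this yields, for every m < |V|, an R-closed set B with |B| = m and a vertex
-- u ∉ B whose successors lie in B; then U = B ∪ {u} has |U| = m + 1 and all
-- R-successors of U lie in B.  Every edge xy with x ∈ U has a common prey v
-- of x and y in D, which is either in B or one of the k new vertices; the
-- in-neighbourhoods (restricted to N_G[U]) of these |B| + k prey are cliques
-- covering E_G[U].  Hence θ_E(E_G[U]; N_G[U]) ≤ |U| - 1 + k, where θ_E exists
-- because the existence of a cover of a given size is decidable (exhaustive
-- search) and we may take the least size.

open import Defs
open import Data.Nat using (ℕ; _≤_)
open import Data.Integer using (+_; _-_; _+_) renaming (_≤_ to _≤ℤ_)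
open import Data.Fin.Subset using (Subset; ∣_∣)
open import Data.Product using (Σ; ∃; _×_)
open import Relation.Binary.PropositionalEquality using (_≡_)

import Data.Nat as ℕ
import Data.Nat.Properties as ℕ
open import Data.Nat.Induction using (<-rec)
open import Data.Integer using (ℤ; -_; +≤+)
open import Data.Integer.Properties using (+-monoˡ-≤; module ≤-Reasoning)
open import Data.Integer.Tactic.RingSolver using (solve-∀)
open import Data.Bool using (true) renaming (_≟_ to _≟ᵇ_)
open import Data.Fin using (Fin; zero; suc; toℕ; fromℕ<; splitAt; _↑ˡ_; _↑ʳ_)
open import Data.Fin.Properties
  using (any?; all?; ¬∀⟶∃¬; pigeonhole; toℕ<n; toℕ-fromℕ<;
         splitAt-↑ˡ; splitAt-↑ʳ; splitAt⁻¹-↑ˡ; splitAt⁻¹-↑ʳ; ↑ˡ-injective)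
  renaming (_≟_ to _≟ᶠ_)
open import Data.Fin.Subset using (_∈_; _∉_; _∪_; ⁅_⁆; ⊤; ⊥; inside; outside)
open import Data.Fin.Subset.Properties
  using (_∈?_; anySubset?; ∉⊥; ∣⊥∣≡0; ∣⊤∣≡n; ⊆⊤; ⊆-antisym; ∪-identityʳ;
         x∈p∪q⁻; p⊆p∪q; x∈⁅y⁆⇒x≡y)
open import Data.Vec using ([]; _∷_; tabulate; here; there)
open import Data.Vec.Properties using (lookup∘tabulate; []=⇒lookup; lookup⇒[]=)
open import Data.Vec.Functional using (head; tail) renaming ([] to []ᶠ; _∷_ to _◃_)
open import Data.Product using (_,_; proj₁; proj₂)
open import Data.Sum using (inj₁; inj₂; [_,_]′)
open import Data.Empty using (⊥-elim)
open import Function using (_∘_)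
open import Relation.Nullary using (Dec; yes; no; does; ¬_; contradiction)
open import Relation.Nullary.Decidable
  using (_×-dec_; _⊎-dec_; _→-dec_; ¬?; map′; dec-true; decidable-stable)
import Relation.Binary.PropositionalEquality as ≡
open ≡ using (refl; trans; cong; subst)
open import Relation.Binary.Construct.Closure.Transitive using (TransClosure; [_]; _∷_; _∷ʳ_)

surplus-bound : ∀ θ m k → θ ≤ m ℕ.+ k → + θ - + ℕ.suc m + + 1 ≤ℤ + k
surplus-bound θ m k θ≤m+k = begin
  + θ - + ℕ.suc m + + 1 ≡⟨ drop-one (+ θ) (+ m) ⟩
  + θ - + m             ≤⟨ +-monoˡ-≤ (- + m) (+≤+ θ≤m+k) ⟩
  + m + + k - + m       ≡⟨ cancel (+ m) (+ k) ⟩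
  + k                   ∎
  where
  open ≤-Reasoning
  drop-one : ∀ (a b : ℤ) → a - (+ 1 + b) + + 1 ≡ a - b
  drop-one = solve-∀
  cancel : ∀ (a b : ℤ) → a + b - a ≡ b
  cancel = solve-∀

least-witness : (P : ℕ → Set) → (∀ t → Dec (P t)) → ∀ {t} → P t →
                ∃ λ s → P s × (∀ t′ → P t′ → s ≤ t′)
least-witness P P? {t} = <-rec (λ t → P t → Least) step t
  where
  Least : Set
  Least = ∃ λ s → P s × (∀ t′ → P t′ → s ≤ t′)
  step : ∀ t → (∀ {s} → s ℕ.< t → P s → Least) → P t → Least
  step t smaller pt with any? (λ (i : Fin t) → P? (toℕ i))
  ... | yes (i , pi) = smaller (toℕ<n i) pi
  ... | no none = t , pt , λ t′ pt′ →
    ℕ.≮⇒≥ (λ t′<t → none (fromℕ< t′<t , subst P (≡.sym (toℕ-fromℕ< t′<t)) pt′))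

⟦_⟧ : ∀ {n} {P : Fin n → Set} → (∀ x → Dec (P x)) → Subset n
⟦ P? ⟧ = tabulate (does ∘ P?)

∈⟦⟧⁻ : ∀ {n} {P : Fin n → Set} (P? : ∀ x → Dec (P x)) {x} → x ∈ ⟦ P? ⟧ → P x
∈⟦⟧⁻ {P = P} P? {x} x∈ =
  yes-witness (P? x) (trans (≡.sym (lookup∘tabulate (does ∘ P?) x)) ([]=⇒lookup x∈))
  where
  yes-witness : (d : Dec (P x)) → does d ≡ true → P x
  yes-witness (yes px) _ = px

∈⟦⟧⁺ : ∀ {n} {P : Fin n → Set} (P? : ∀ x → Dec (P x)) {x} → P x → x ∈ ⟦ P? ⟧
∈⟦⟧⁺ P? {x} px = lookup⇒[]= x _ (trans (lookup∘tabulate (does ∘ P?) x) (dec-true (P? x) px))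

∣p∪⁅x⁆∣ : ∀ {n} {p : Subset n} {x} → x ∉ p → ∣ p ∪ ⁅ x ⁆ ∣ ≡ ℕ.suc ∣ p ∣
∣p∪⁅x⁆∣ {p = outside ∷ p} {zero} _ = cong (ℕ.suc ∘ ∣_∣) (∪-identityʳ p)
∣p∪⁅x⁆∣ {p = inside ∷ p} {zero} x∉ = contradiction here x∉
∣p∪⁅x⁆∣ {p = outside ∷ p} {suc x} x∉ = ∣p∪⁅x⁆∣ (x∉ ∘ there)
∣p∪⁅x⁆∣ {p = inside ∷ p} {suc x} x∉ = cong ℕ.suc (∣p∪⁅x⁆∣ (x∉ ∘ there))

nonfull : ∀ {n} {p : Subset n} → ∣ p ∣ ℕ.< n → ∃ λ x → x ∉ p
nonfull {n} {p} small = ¬∀⟶∃¬ n (_∈ p) (_∈? p) λ all∈ →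
  ℕ.<-irrefl (trans (cong ∣_∣ (⊆-antisym ⊆⊤ (λ {x} _ → all∈ x))) (∣⊤∣≡n n)) small

enumerate : ∀ {n} (p : Subset n) → Σ (Fin ∣ p ∣ → Fin n) λ e → ∀ {x} → x ∈ p → ∃ λ i → e i ≡ x
enumerate [] = (λ ()) , λ ()
enumerate (outside ∷ p) with enumerate p
... | e , onto = suc ∘ e , λ { (there x∈) → let (i , eq) = onto x∈ in i , cong suc eq }
enumerate (inside ∷ p) with enumerate p
... | e , onto = e′ , onto′
  where
  e′ : Fin (ℕ.suc ∣ p ∣) → Fin _
  e′ zero = zero
  e′ (suc i) = suc (e i)
  onto′ : ∀ {x} → x ∈ inside ∷ p → ∃ λ i → e′ i ≡ x
  onto′ here = zero , refl
  onto′ (there x∈) = let (i , eq) = onto x∈ in suc i , cong suc eq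

PointwiseInvariant : ∀ {n t} → ((Fin t → Subset n) → Set) → Set
PointwiseInvariant Q = ∀ C C′ → (∀ i → C i ≡ C′ i) → Q C → Q C′

families? : ∀ {n} t {Q : (Fin t → Subset n) → Set} →
            (∀ C → Dec (Q C)) → PointwiseInvariant Q → Dec (∃ Q)
families? ℕ.zero Q? inv =
  map′ (λ q → []ᶠ , q) (λ (C , q) → inv C []ᶠ (λ ()) q) (Q? []ᶠ)
families? (ℕ.suc t) Q? inv =
  map′ (λ (c , C , q) → c ◃ C , q)
       (λ (C , q) → head C , tail C , inv C _ (λ { zero → refl ; (suc i) → refl }) q)
       (anySubset? λ c → families? t (Q? ∘ (c ◃_))
          (λ C C′ eq → inv _ _ (λ { zero → refl ; (suc i) → eq i })))

module _ {n} (G : Graph n) {W : Fin n → Set} {F : Fin n → Fin n → Set}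
         (W? : ∀ x → Dec (W x)) (F? : ∀ x y → Dec (F x y)) where

  isClique? : ∀ C → Dec (IsCliqueIn G W C)
  isClique? C = all? (λ x → x ∈? C →-dec W? x) ×-dec
                all? (λ x → all? (λ y → x ∈? C →-dec (y ∈? C →-dec
                  (¬? (x ≟ᶠ y) →-dec adj G x y ≟ᵇ true))))

  isCover? : ∀ t C → Dec (IsEdgeCliqueCover G W F t C)
  isCover? t C = all? (isClique? ∘ C) ×-dec
                 all? (λ x → all? (λ y → F? x y →-dec any? (λ i → x ∈? C i ×-dec y ∈? C i)))

  cover-invariant : ∀ t → PointwiseInvariant (IsEdgeCliqueCover G W F t)
  cover-invariant t C C′ C≡C′ (cliques , covers) =
    (λ i → subst (IsCliqueIn G W) (C≡C′ i) (cliques i)) ,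
    (λ x y f → let (i , x∈ , y∈) = covers x y f
               in i , subst (x ∈_) (C≡C′ i) x∈ , subst (y ∈_) (C≡C′ i) y∈)

  thetaE-exists : ∀ {t} {C : Fin t → Subset n} → IsEdgeCliqueCover G W F t C →
                  ∃ λ θ → IsThetaE G W F θ × θ ≤ t
  thetaE-exists {t} {C} cover
    with least-witness _ (λ t → families? t (isCover? t) (cover-invariant t)) (C , cover)
  ... | θ , θ-cover , θ-least =
    θ , (θ-cover , λ t′ C′ cover′ → θ-least t′ (C′ , cover′)) , θ-least t (C , cover)

closedNbhd? : ∀ {n} (G : Graph n) U x → Dec (ClosedNbhd G U x)
closedNbhd? G U x = x ∈? U ⊎-dec any? (λ u → u ∈? U ×-dec adj G u x ≟ᵇ true)

edgesAt? : ∀ {n} (G : Graph n) U x y → Dec (EdgesAt G U x y)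
edgesAt? G U x y = adj G x y ≟ᵇ true ×-dec (x ∈? U ⊎-dec y ∈? U)

module _ {n} {R : Fin n → Fin n → Set} (R? : ∀ a b → Dec (R a b))
         (acyclic : ∀ x → ¬ TransClosure R x x) where

  -- If every P-element has an R-successor in P, then an R-walk of n + 1 steps
  -- inside P revisits a vertex (pigeonhole), contradicting acyclicity.
  successors⇒cycle : ∀ {P : Fin n → Set} → (∀ {x} → P x → ∃ λ y → R x y × P y) →
                     ∀ {x₀} → P x₀ → ∃ λ x → TransClosure R x x
  successors⇒cycle {P} next {x₀} p₀ =
    let (i , j , i<j , xᵢ≡xⱼ) = pigeonhole (ℕ.n<1+n n) (xs ∘ toℕ)
    in revisit⇒cycle (toℕ i) (toℕ j) i<j xᵢ≡xⱼ
    where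
    walk : ℕ → Σ (Fin n) P
    walk ℕ.zero = x₀ , p₀
    walk (ℕ.suc i) = let (y , _ , py) = next (proj₂ (walk i)) in y , py
    xs : ℕ → Fin n
    xs = proj₁ ∘ walk
    step : ∀ i → R (xs i) (xs (ℕ.suc i))
    step i = proj₁ (proj₂ (next (proj₂ (walk i))))
    path : ∀ a d → TransClosure R (xs a) (xs (d ℕ.+ ℕ.suc a))
    path a ℕ.zero = [ step a ]
    path a (ℕ.suc d) = path a d ∷ʳ step (d ℕ.+ ℕ.suc a)
    revisit⇒cycle : ∀ i j → i ℕ.< j → xs i ≡ xs j → ∃ λ x → TransClosure R x x
    revisit⇒cycle i j i<j xᵢ≡xⱼ = xs i ,
      subst (TransClosure R (xs i)) (trans (cong xs (ℕ.m∸n+n≡m i<j)) (≡.sym xᵢ≡xⱼ))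
            (path i (j ℕ.∸ ℕ.suc i))

  sink : ∀ {P : Fin n → Set} → (∀ x → Dec (P x)) → ∀ {x₀} → P x₀ →
         ∃ λ u → P u × (∀ b → R u b → ¬ P b)
  sink {P} P? p₀ with any? (λ u → P? u ×-dec all? (λ b → R? u b →-dec ¬? (P? b)))
  ... | yes found = found
  ... | no none = let (x , cycle) = successors⇒cycle next p₀ in ⊥-elim (acyclic x cycle)
    where
    next : ∀ {x} → P x → ∃ λ y → R x y × P y
    next {x} px with any? (λ y → R? x y ×-dec P? y)
    ... | yes found = found
    ... | no none′ = ⊥-elim (none (x , px , λ y r py → none′ (y , r , py)))

  SuccessorsIn : Subset n → Subset n → Set
  SuccessorsIn U B = ∀ {a b} → a ∈ U → R a b → b ∈ B

  Closed : Subset n → Set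
  Closed U = SuccessorsIn U U

  extend : ∀ {B} → Closed B → ∣ B ∣ ℕ.< n → ∃ λ u → u ∉ B × SuccessorsIn (B ∪ ⁅ u ⁆) B
  extend {B} closed small with nonfull small
  ... | x₀ , x₀∉B with sink (λ x → ¬? (x ∈? B)) x₀∉B
  ... | u , u∉B , u-sink = u , u∉B , successors
    where
    successors : SuccessorsIn (B ∪ ⁅ u ⁆) B
    successors {a} {b} a∈ r with x∈p∪q⁻ B ⁅ u ⁆ a∈
    ... | inj₁ a∈B = closed a∈B r
    ... | inj₂ a∈⁅u⁆ rewrite x∈⁅y⁆⇒x≡y u a∈⁅u⁆ = decidable-stable (b ∈? B) (u-sink b r)

  closed-of-size : ∀ m → m ≤ n → ∃ λ B → ∣ B ∣ ≡ m × Closed B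
  closed-of-size ℕ.zero _ = ⊥ , ∣⊥∣≡0 n , λ a∈⊥ → contradiction a∈⊥ ∉⊥
  closed-of-size (ℕ.suc m) m<n with closed-of-size m (ℕ.<⇒≤ m<n)
  ... | B , refl , closed with extend closed m<n
  ... | u , u∉B , successors = B ∪ ⁅ u ⁆ , ∣p∪⁅x⁆∣ u∉B , λ a∈ r → p⊆p∪q ⁅ u ⁆ (successors a∈ r)

  layer : ∀ m → m ℕ.< n → ∃ λ B → ∣ B ∣ ≡ m × ∃ λ u → u ∉ B × SuccessorsIn (B ∪ ⁅ u ⁆) B
  layer m m<n with closed-of-size m (ℕ.<⇒≤ m<n)
  ... | B , refl , closed = B , refl , extend closed m<n

module _ {n k} (G : Graph n) (D : Digraph (n ℕ.+ k)) (competition : IsCompetitionGraphOf G k D) where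

  ι : Fin n → Fin (n ℕ.+ k)
  ι x = x ↑ˡ k

  Arcᴳ : Fin n → Fin n → Set
  Arcᴳ a b = Arc D (ι a) (ι b)

  arcᴳ? : ∀ a b → Dec (Arcᴳ a b)
  arcᴳ? a b = D (ι a) (ι b) ≟ᵇ true

  acyclicᴳ : Acyclic D → ∀ x → ¬ TransClosure Arcᴳ x x
  acyclicᴳ acyclic x = acyclic (ι x) ∘ embed
    where
    embed : ∀ {a b} → TransClosure Arcᴳ a b → TransClosure (Arc D) (ι a) (ι b)
    embed [ r ] = [ r ]
    embed (r ∷ rs) = r ∷ embed rs

  addIsolated-ι : ∀ x y → addIsolated G k (ι x) (ι y) ≡ adj G x y
  addIsolated-ι x y rewrite splitAt-↑ˡ n x k | splitAt-↑ˡ n y k = refl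

  common-prey : ∀ {x y} → Adj G x y → ∃ λ v → Arc D (ι x) v × Arc D (ι y) v
  common-prey {x} {y} xy = proj₂ (proj₁ (competition (ι x) (ι y)) (trans (addIsolated-ι x y) xy))

  prey-adjacent : ∀ {x y v} → x ≡.≢ y → Arc D (ι x) v → Arc D (ι y) v → Adj G x y
  prey-adjacent {x} {y} x≢y xv yv = trans (≡.sym (addIsolated-ι x y))
    (proj₂ (competition (ι x) (ι y)) ((x≢y ∘ ↑ˡ-injective k x y) , _ , xv , yv))

  module PreyCover (U B : Subset n) (succ⊆B : ∀ {a b} → a ∈ U → Arcᴳ a b → b ∈ B) where

    W : Fin n → Set
    W = ClosedNbhd G U

    prey : Fin (∣ B ∣ ℕ.+ k) → Fin (n ℕ.+ k)
    prey i = [ ι ∘ proj₁ (enumerate B) , n ↑ʳ_ ]′ (splitAt ∣ B ∣ i)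

    prey-listed : ∀ {x v} → x ∈ U → Arc D (ι x) v → ∃ λ i → prey i ≡ v
    prey-listed {x} {v} x∈U xv with splitAt n v in split
    ... | inj₂ j rewrite ≡.sym (splitAt⁻¹-↑ʳ split) =
      ∣ B ∣ ↑ʳ j , cong [ _ , n ↑ʳ_ ]′ (splitAt-↑ʳ ∣ B ∣ k j)
    ... | inj₁ w rewrite ≡.sym (splitAt⁻¹-↑ˡ split)
      with proj₂ (enumerate B) (succ⊆B x∈U xv)
    ... | i , eᵢ≡w = i ↑ˡ k , trans (cong [ _ , n ↑ʳ_ ]′ (splitAt-↑ˡ ∣ B ∣ i k)) (cong ι eᵢ≡w)

    preys-on? : ∀ i x → Dec (W x × Arc D (ι x) (prey i))
    preys-on? i x = closedNbhd? G U x ×-dec D (ι x) (prey i) ≟ᵇ true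

    clique : Fin (∣ B ∣ ℕ.+ k) → Subset n
    clique i = ⟦ preys-on? i ⟧

    in-clique : ∀ {x i} → W x → Arc D (ι x) (prey i) → x ∈ clique i
    in-clique {i = i} w xv = ∈⟦⟧⁺ (preys-on? i) (w , xv)

    clique-member : ∀ {x i} → x ∈ clique i → W x × Arc D (ι x) (prey i)
    clique-member {i = i} = ∈⟦⟧⁻ (preys-on? i)

    is-clique : ∀ i → IsCliqueIn G W (clique i)
    is-clique i = (λ x x∈ → proj₁ (clique-member x∈)) ,
                  (λ x y x∈ y∈ x≢y →
                     prey-adjacent x≢y (proj₂ (clique-member x∈)) (proj₂ (clique-member y∈)))

    covers-from : ∀ {x y} → Adj G x y → x ∈ U → ∃ λ i → x ∈ clique i × y ∈ clique i
    covers-from {x} {y} xy x∈U with common-prey xy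
    ... | v , xv , yv with prey-listed x∈U xv
    ... | i , refl = i , in-clique (inj₁ x∈U) xv , in-clique (inj₂ (x , x∈U , xy)) yv

    cover : IsEdgeCliqueCover G W (EdgesAt G U) (∣ B ∣ ℕ.+ k) clique
    cover = is-clique , covered
      where
      covered : ∀ x y → EdgesAt G U x y → ∃ λ i → x ∈ clique i × y ∈ clique i
      covered x y (xy , inj₁ x∈U) = covers-from xy x∈U
      covered x y (xy , inj₂ y∈U) =
        let (i , y∈ , x∈) = covers-from (trans (sym G y x) xy) y∈U in i , x∈ , y∈

theorem3 : ∀ (n : ℕ) (G : Graph n) (k : ℕ) → IsCompetitionNumber G k →
    ∀ (m : ℕ) → 1 ≤ m → m ≤ n →
    Σ (Subset n) λ U → ∣ U ∣ ≡ m ×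
      (∃ λ θ → IsThetaE G (ClosedNbhd G U) (EdgesAt G U) θ
               × (+ θ - + ∣ U ∣ + + 1) ≤ℤ + k)
theorem3 n G k ((D , acyclic , competition) , _) (ℕ.suc m) _ m<n
  with layer (arcᴳ? G D competition) (acyclicᴳ G D competition acyclic) m m<n
... | B , refl , u , u∉B , succ⊆B
  with thetaE-exists G (closedNbhd? G (B ∪ ⁅ u ⁆)) (edgesAt? G (B ∪ ⁅ u ⁆))
         (PreyCover.cover G D competition (B ∪ ⁅ u ⁆) B succ⊆B)
... | θ , isθ , θ≤|B|+k =
  B ∪ ⁅ u ⁆ , ∣p∪⁅x⁆∣ u∉B , θ , isθ ,
  subst (λ s → + θ - + s + + 1 ≤ℤ + k) (≡.sym (∣p∪⁅x⁆∣ u∉B)) (surplus-bound θ ∣ B ∣ k θ≤|B|+k)
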